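{- Let $B,C\in\mathbf{K}_0$ with $C$ a primitive extension of $B$. Then either $\delta(C)-\delta(B)=1$ and $C=B\cup\{c\}$ for a single element $c$, or $\delta(C)-\delta(B)=0$.
   Context: A plane is a structure $(V,R)$ with $R$ a ternary relation holding only of triples of pairwise distinct elements, invariant under permutations, such that $R(a,b,c)$ and $R(a,b,d)$ imply that every three distinct elements of $\{a,b,c,d\}$ satisfy $R$. Lines are the sets $a\vee b=\{a,b\}\cup\{c:R(a,b,c)\}$ for distinct $a,b$; subsets of planes are planes with induced relation. For a finite plane $A$, $\delta(A)=|A|-\sum_{\ell}(|\ell|-2)$ over lines $\ell$ of $A$. $\mathbf{K}_0$ is the class of finite planes $A$ with $\delta(A')\ge0$ for all $A'\subseteq A$. For $A\subseteq B\in\mathbf{K}_0$, $A\le B$ iff $\delta(X)\ge\delta(A)$ for all $X$ with $A\subseteq X\subseteq B$. $C$ is a primitive extension of $B$ if $B\le C$ and there is no $C_0$ with $B\subsetneq C_0\subsetneq C$ and $B\le C_0\le C$. -}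

module Defs where

open import Data.Bool using (Bool; true; false; _∧_; _∨_; not; if_then_else_)
open import Data.Nat using (ℕ; zero; suc; _∸_)
open import Data.Integer using (ℤ; +_; _-_)
open import Data.Fin using (Fin; _≟_)
open import Data.Fin.Subset using (Subset; inside; outside; ∣_∣; _∈_; _⊆_)
open import Data.Vec using (Vec; []; _∷_; tabulate; lookup)
open import Data.Vec.Properties using (≡-dec)
open import Data.List using (List; []; _∷_; _++_; map; allFin; filterᵇ)
open import Data.Bool.ListAction using (any)
open import Data.Nat.ListAction using (sum)
open import Data.Sum using (_⊎_)
open import Data.Product using (_×_)
open import Relation.Binary.PropositionalEquality using (_≡_; _≢_)
open import Relation.Nullary.Decidable using (⌊_⌋)
import Data.Bool.Properties as BoolP

In4 : ∀ {n} → Fin n → Fin n → Fin n → Fin n → Fin n → Set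
In4 x a b c d = x ≡ a ⊎ x ≡ b ⊎ x ≡ c ⊎ x ≡ d

-- A (finite) plane with universe Fin n; the ternary relation is Bool-valued
-- (every relation on a finite set is decidable, so no loss of generality).
record Plane (n : ℕ) : Set where
  field
    R       : Fin n → Fin n → Fin n → Bool
    R-distinct : ∀ a b c → R a b c ≡ true → a ≢ b × b ≢ c × a ≢ c
    -- invariance under permutations (transpositions generate S₃)
    R-swap₁ : ∀ a b c → R a b c ≡ true → R b a c ≡ true
    R-swap₂ : ∀ a b c → R a b c ≡ true → R a c b ≡ true
    R-line  : ∀ a b c d → R a b c ≡ true → R a b d ≡ true →
              ∀ x y z → In4 x a b c d → In4 y a b c d → In4 z a b c d →
              x ≢ y → y ≢ z → x ≢ z → R x y z ≡ true

module _ {n : ℕ} (P : Plane n) where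
  open Plane P

  eqᵇ : Fin n → Fin n → Bool
  eqᵇ x y = ⌊ x ≟ y ⌋

  memᵇ : Fin n → Subset n → Bool
  memᵇ x X = lookup X x

  subsetEqᵇ : Subset n → Subset n → Bool
  subsetEqᵇ L M = ⌊ ≡-dec BoolP._≟_ L M ⌋

  lineIn : Subset n → Fin n → Fin n → Subset n
  lineIn X a b = tabulate λ c → memᵇ c X ∧ (eqᵇ c a ∨ eqᵇ c b ∨ R a b c)

  isLineᵇ : Subset n → Subset n → Bool
  isLineᵇ X L = any (λ a → any (λ b →
      memᵇ a X ∧ memᵇ b X ∧ not (eqᵇ a b) ∧ subsetEqᵇ (lineIn X a b) L)
      (allFin n)) (allFin n)

allSubsets : (n : ℕ) → List (Subset n)
allSubsets zero = [] ∷ []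
allSubsets (suc n) = map (outside ∷_) (allSubsets n) ++ map (inside ∷_) (allSubsets n)

module _ {n : ℕ} (P : Plane n) where
  -- lines of the subplane X (each listed once)
  linesOf : Subset n → List (Subset n)
  linesOf X = filterᵇ (isLineᵇ P X) (allSubsets n)

  δ : Subset n → ℤ
  δ X = + ∣ X ∣ - + sum (map (λ L → ∣ L ∣ ∸ 2) (linesOf X))

  InK₀ : Subset n → Set
  InK₀ X = ∀ Y → Y ⊆ X → + 0 Data.Integer.≤ δ Y

  _≤ₛ_ : Subset n → Subset n → Set
  A ≤ₛ B = A ⊆ B × (∀ X → A ⊆ X → X ⊆ B → δ A Data.Integer.≤ δ X)

module Submission where

-- Write C for the whole plane (the subset ⊤) and let B ≤ C be primitive.
-- The proof rests on two facts.
--   (1) Adding one point raises δ by at most one: the lines of B are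
--       restrictions of lines of B ∪ {c}, distinct lines restrict to
--       distinct lines, and restriction does not increase |ℓ| - 2.  Hence
--       the line excess Σ (|ℓ| - 2) is monotone under inclusion, while the
--       cardinality grows by exactly one.
--   (2) Primitivity makes δ(C) the least value of δ on proper supersets of
--       B: if δ(Y) < δ(C) for some B ⊊ Y, then Y is not strong in C
--       (otherwise primitivity forces Y = C), so some X ⊇ Y has a smaller δ;
--       iterating this descent must stop, because δ is bounded below by δ(B).
-- For B ≠ C pick c ∉ B; then δ(B) ≤ δ(C) ≤ δ(B ∪ {c}) ≤ δ(B) + 1, so the gap
-- is 0 or 1.  If it is 1, then δ(B ∪ {c}) ≤ δ(C) ≤ δ(Y) for every Y ⊇ B ∪ {c},
-- i.e. B ∪ {c} is strong in C, and primitivity gives C = B ∪ {c}.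

open import Defs
open import Algebra.Bundles using (AbelianGroup)
open import Data.Bool using (Bool; true; false; T; T?; not; _∧_; _∨_)
open import Data.Bool.Properties using (T-≡; T-∧; ∧-zeroʳ; ∧-identityʳ)
open import Data.Bool.ListAction using (any)
open import Data.Fin using (Fin; zero; suc)
open import Data.Fin.Properties using (all?; ¬∀⟶∃¬)
open import Data.Fin.Subset using (Subset; ⊤; ⁅_⁆; _∪_; _∩_; _⊂_; _⊆_; _∉_; ∣_∣)
import Data.Fin.Subset as Subset
open import Data.Fin.Subset.Properties
  using (_∈?_; ⊆⊤; ∈⊤; ⊆-antisym; ⊂-⊆-trans; p⊆p∪q; q⊆p∪q; x∈⁅x⁆; ∪-identityʳ; ∣p∩q∣≤∣p∣)
open import Data.Integer using (ℤ; +_; -[1+_]; _-_; -_; _⊖_; +≤+; +<+)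
import Data.Integer as ℤ
import Data.Integer.Properties as ℤP
open import Data.List using (List; []; _∷_; map; allFin)
open import Data.List.Membership.Propositional using (_∈_)
open import Data.List.Membership.Propositional.Properties
  using (∈-allFin; ∈-filter⁺; ∈-filter⁻; ∈-map⁺; ∈-map⁻; ∈-++⁺ˡ; ∈-++⁺ʳ)
open import Data.List.Relation.Unary.All as All using ([])
open import Data.List.Relation.Unary.AllPairs using ([]; _∷_)
open import Data.List.Relation.Unary.Any as Any using (here; there)
open import Data.List.Relation.Unary.Any.Properties using (any⁺; any⁻)
open import Data.List.Relation.Unary.Unique.Propositional using (Unique)
import Data.List.Relation.Unary.Unique.Propositional.Properties as Unique
open import Data.Nat using (ℕ; zero; suc; _+_; _∸_; z≤n)
import Data.Nat as ℕ
import Data.Nat.Properties as ℕP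
open import Data.Nat.ListAction using (sum)
open import Data.Product using (_×_; _,_; Σ; ∃; proj₁; proj₂)
open import Data.Sum using (_⊎_; inj₁; inj₂)
open import Data.Vec using (_∷_; lookup)
open import Data.Vec.Properties
  using (≡-dec; lookup⇒[]=; []=⇒lookup; lookup-zipWith; lookup∘tabulate; tabulate∘lookup; tabulate-cong)
open import Function using (_∘_; Equivalence)
open import Relation.Binary.Definitions using (DecidableEquality)
open import Relation.Binary.PropositionalEquality
open import Relation.Nullary using (¬_; yes; no; contradiction)
open import Relation.Nullary.Decidable using (toWitness; fromWitness; toWitnessFalse; fromWitnessFalse)

open import Algebra.Properties.CommutativeSemigroup ℕP.+-commutativeSemigroup using (x∙yz≈y∙xz)
open import Algebra.Properties.Group (AbelianGroup.group ℤP.+-0-abelianGroup)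
  using (//-rightDividesˡ; //-rightDividesʳ)

open Equivalence using (to; from)

module Removal {B : Set} (_≟ᴮ_ : DecidableEquality B) where

  remove : B → List B → List B
  remove y [] = []
  remove y (z ∷ zs) with y ≟ᴮ z
  ... | yes _ = zs
  ... | no _ = z ∷ remove y zs

  sum-remove : (f : B → ℕ) {y : B} {ys : List B} → y ∈ ys →
               f y + sum (map f (remove y ys)) ℕ.≤ sum (map f ys)
  sum-remove f {y} {z ∷ zs} y∈ with y ≟ᴮ z | y∈
  ... | yes refl | _ = ℕP.≤-refl
  ... | no y≢z | here y≡z = contradiction y≡z y≢z
  ... | no _ | there y∈zs = begin
      f y + (f z + sum (map f (remove y zs))) ≡⟨ x∙yz≈y∙xz (f y) (f z) _ ⟩
      f z + (f y + sum (map f (remove y zs))) ≤⟨ ℕP.+-monoʳ-≤ (f z) (sum-remove f y∈zs) ⟩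
      f z + sum (map f zs)                    ∎
    where open ℕP.≤-Reasoning

  ∈-remove : {y y′ : B} {ys : List B} → y′ ∈ ys → y′ ≢ y → y′ ∈ remove y ys
  ∈-remove {y} {ys = z ∷ zs} y′∈ y′≢y with y ≟ᴮ z | y′∈
  ... | yes refl | here y′≡y = contradiction y′≡y y′≢y
  ... | yes refl | there y′∈zs = y′∈zs
  ... | no _ | here y′≡z = here y′≡z
  ... | no _ | there y′∈zs = there (∈-remove y′∈zs y′≢y)

  sum-≤-by-injection : {A : Set} (ρ : B → A) (w : A → ℕ) (w′ : B → ℕ)
    (xs : List A) → Unique xs → (ys : List B) →
    (∀ {x} → x ∈ xs → ∃ λ y → y ∈ ys × ρ y ≡ x × w x ℕ.≤ w′ y) →
    sum (map w xs) ℕ.≤ sum (map w′ ys)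
  sum-≤-by-injection ρ w w′ [] _ ys _ = z≤n
  sum-≤-by-injection ρ w w′ (x ∷ xs) (x∉xs ∷ xs-unique) ys preimage
    with preimage (here refl)
  ... | y , y∈ys , ρy≡x , wx≤w′y = begin
      w x + sum (map w xs)
        ≤⟨ ℕP.+-mono-≤ wx≤w′y (sum-≤-by-injection ρ w w′ xs xs-unique (remove y ys) preimage′) ⟩
      w′ y + sum (map w′ (remove y ys))
        ≤⟨ sum-remove w′ y∈ys ⟩
      sum (map w′ ys) ∎
    where
      open ℕP.≤-Reasoning
      -- the preimages of the remaining elements differ from y, since ρ y = x ∉ xs
      preimage′ : ∀ {x′} → x′ ∈ xs → ∃ λ y′ → y′ ∈ remove y ys × ρ y′ ≡ x′ × w x′ ℕ.≤ w′ y′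
      preimage′ x′∈xs with preimage (there x′∈xs)
      ... | y′ , y′∈ys , ρy′≡x′ , le =
        y′ , ∈-remove y′∈ys (λ { refl → All.lookup x∉xs x′∈xs (trans (sym ρy≡x) ρy′≡x′) }) , ρy′≡x′ , le

_≟ˢ_ : ∀ {n} → DecidableEquality (Subset n)
_≟ˢ_ = ≡-dec Data.Bool._≟_

T-lookup⇒∈ : ∀ {n} {x : Fin n} {X : Subset n} → T (lookup X x) → x Subset.∈ X
T-lookup⇒∈ {x = x} {X} t = lookup⇒[]= x X (to T-≡ t)

∈⇒T-lookup : ∀ {n} {x : Fin n} {X : Subset n} → x Subset.∈ X → T (lookup X x)
∈⇒T-lookup x∈X = from T-≡ ([]=⇒lookup x∈X)

allSubsets-complete : ∀ {n} (X : Subset n) → X ∈ allSubsets n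
allSubsets-complete {zero} Data.Vec.[] = here refl
allSubsets-complete {suc n} (false ∷ X) = ∈-++⁺ˡ (∈-map⁺ (false ∷_) (allSubsets-complete X))
allSubsets-complete {suc n} (true ∷ X) =
  ∈-++⁺ʳ (map (false ∷_) (allSubsets n)) (∈-map⁺ (true ∷_) (allSubsets-complete X))

allSubsets-unique : ∀ n → Unique (allSubsets n)
allSubsets-unique zero = [] ∷ []
allSubsets-unique (suc n) =
  Unique.++⁺ (Unique.map⁺ ∷-injective (allSubsets-unique n))
             (Unique.map⁺ ∷-injective (allSubsets-unique n)) disjoint
  where
    ∷-injective : ∀ {b : Bool} {X Y : Subset n} → b ∷ X ≡ b ∷ Y → X ≡ Y
    ∷-injective refl = refl
    disjoint : ∀ {X} → ¬ (X ∈ map (false ∷_) (allSubsets n) × X ∈ map (true ∷_) (allSubsets n))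
    disjoint (X∈₀ , X∈₁) with ∈-map⁻ (false ∷_) X∈₀ | ∈-map⁻ (true ∷_) X∈₁
    ... | _ , _ , refl | _ , _ , ()

module Lines {n : ℕ} (P : Plane n) where

  spans : Subset n → Subset n → Fin n → Fin n → Bool
  spans X L a b = memᵇ P a X ∧ memᵇ P b X ∧ not (eqᵇ P a b) ∧ subsetEqᵇ P (lineIn P X a b) L

  spans⇒ : ∀ X L a b → T (spans X L a b) →
           a Subset.∈ X × b Subset.∈ X × a ≢ b × lineIn P X a b ≡ L
  spans⇒ X L a b t =
    let a∈X , t₁ = to (T-∧ {memᵇ P a X}) t
        b∈X , t₂ = to (T-∧ {memᵇ P b X}) t₁
        a≢b , t₃ = to (T-∧ {not (eqᵇ P a b)}) t₂
    in T-lookup⇒∈ a∈X , T-lookup⇒∈ b∈X , toWitnessFalse a≢b , toWitness t₃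

  spans⇐ : ∀ X a b → a Subset.∈ X → b Subset.∈ X → a ≢ b → T (spans X (lineIn P X a b) a b)
  spans⇐ X a b a∈X b∈X a≢b =
    from (T-∧ {memᵇ P a X}) (∈⇒T-lookup a∈X , from (T-∧ {memᵇ P b X}) (∈⇒T-lookup b∈X ,
    from (T-∧ {not (eqᵇ P a b)}) (fromWitnessFalse a≢b , fromWitness refl)))

  isLine⇒ : (X L : Subset n) → T (isLineᵇ P X L) →
    ∃ λ a → ∃ λ b → a Subset.∈ X × b Subset.∈ X × a ≢ b × lineIn P X a b ≡ L
  isLine⇒ X L t =
    let a , t₁ = Any.satisfied (any⁻ (λ a → any (spans X L a) (allFin n)) (allFin n) t)
        b , t₂ = Any.satisfied (any⁻ (spans X L a) (allFin n) t₁)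
    in a , b , spans⇒ X L a b t₂

  isLine⇐ : (X : Subset n) {a b : Fin n} → a Subset.∈ X → b Subset.∈ X → a ≢ b →
            T (isLineᵇ P X (lineIn P X a b))
  isLine⇐ X {a} {b} a∈X b∈X a≢b =
    any⁺ (λ a′ → any (spans X L a′) (allFin n))
      (Any.map (λ { refl → any⁺ (spans X L a) (Any.map (λ { refl → spans⇐ X a b a∈X b∈X a≢b }) (∈-allFin b)) })
               (∈-allFin a))
    where
      L : Subset n
      L = lineIn P X a b

  ∈-linesOf⁺ : (X L : Subset n) → T (isLineᵇ P X L) → L ∈ linesOf P X
  ∈-linesOf⁺ X L = ∈-filter⁺ (T? ∘ isLineᵇ P X) (allSubsets-complete L)

  ∈-linesOf⁻ : (X L : Subset n) → L ∈ linesOf P X → T (isLineᵇ P X L)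
  ∈-linesOf⁻ X L L∈ = proj₂ (∈-filter⁻ (T? ∘ isLineᵇ P X) {xs = allSubsets n} L∈)

  linesOf-unique : (X : Subset n) → Unique (linesOf P X)
  linesOf-unique X = Unique.filter⁺ _ (allSubsets-unique n)

  private
    ∧-restrict : ∀ x y q → (y ≡ true → x ≡ true) → (x ∧ q) ∧ y ≡ y ∧ q
    ∧-restrict x false q _ = ∧-zeroʳ (x ∧ q)
    ∧-restrict x true q y⇒x rewrite y⇒x refl = ∧-identityʳ q

  lineIn-∩ : {X Y : Subset n} → Y ⊆ X → (a b : Fin n) → lineIn P X a b ∩ Y ≡ lineIn P Y a b
  lineIn-∩ {X} {Y} Y⊆X a b = trans (sym (tabulate∘lookup (lineIn P X a b ∩ Y))) (tabulate-cong pointwise)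
    where
      onLine : Fin n → Bool
      onLine c = eqᵇ P c a ∨ eqᵇ P c b ∨ Plane.R P a b c
      pointwise : ∀ c → lookup (lineIn P X a b ∩ Y) c ≡ lookup Y c ∧ onLine c
      pointwise c = begin
        lookup (lineIn P X a b ∩ Y) c          ≡⟨ lookup-zipWith _∧_ c (lineIn P X a b) Y ⟩
        lookup (lineIn P X a b) c ∧ lookup Y c ≡⟨ cong (_∧ lookup Y c) (lookup∘tabulate _ c) ⟩
        (lookup X c ∧ onLine c) ∧ lookup Y c   ≡⟨ ∧-restrict _ _ _ (λ e → []=⇒lookup (Y⊆X (lookup⇒[]= c Y e))) ⟩
        lookup Y c ∧ onLine c                  ∎
        where open ≡-Reasoning

  lineWeight : Subset n → ℕ
  lineWeight L = ∣ L ∣ ∸ 2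

  lineExcess : Subset n → ℕ
  lineExcess X = sum (map lineWeight (linesOf P X))

  -- Every line M of Y is M = L ∩ Y for a line L of X of at least its weight.
  lineExcess-mono : {X Y : Subset n} → Y ⊆ X → lineExcess Y ℕ.≤ lineExcess X
  lineExcess-mono {X} {Y} Y⊆X =
    Removal.sum-≤-by-injection _≟ˢ_ (_∩ Y) lineWeight lineWeight (linesOf P Y) (linesOf-unique Y) (linesOf P X) extend
    where
      extend : ∀ {M} → M ∈ linesOf P Y →
               ∃ λ L → L ∈ linesOf P X × L ∩ Y ≡ M × lineWeight M ℕ.≤ lineWeight L
      extend {M} M∈ with isLine⇒ Y M (∈-linesOf⁻ Y M M∈)
      ... | a , b , a∈Y , b∈Y , a≢b , refl =
        lineIn P X a b ,
        ∈-linesOf⁺ X (lineIn P X a b) (isLine⇐ X (Y⊆X a∈Y) (Y⊆X b∈Y) a≢b) ,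
        lineIn-∩ Y⊆X a b ,
        subst (λ M → lineWeight M ℕ.≤ lineWeight (lineIn P X a b)) (lineIn-∩ Y⊆X a b)
              (ℕP.∸-monoˡ-≤ 2 (∣p∩q∣≤∣p∣ (lineIn P X a b) Y))

∣∪⁅new⁆∣ : ∀ {n} (B : Subset n) (c : Fin n) → c ∉ B → ∣ B ∪ ⁅ c ⁆ ∣ ≡ suc ∣ B ∣
∣∪⁅new⁆∣ (false ∷ B) zero _ rewrite ∪-identityʳ B = refl
∣∪⁅new⁆∣ (true ∷ B) zero c∉B = contradiction Data.Vec.here c∉B
∣∪⁅new⁆∣ (false ∷ B) (suc c) c∉B = ∣∪⁅new⁆∣ B c (c∉B ∘ Data.Vec.there)
∣∪⁅new⁆∣ (true ∷ B) (suc c) c∉B = cong suc (∣∪⁅new⁆∣ B c (c∉B ∘ Data.Vec.there))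

δ-adjoin : ∀ {n} (P : Plane n) {B : Subset n} {c : Fin n} → c ∉ B → δ P (B ∪ ⁅ c ⁆) ℤ.≤ + 1 ℤ.+ δ P B
δ-adjoin P {B} {c} c∉B = begin
  δ P (B ∪ ⁅ c ⁆)
    ≡⟨ ℤP.[+m]-[+n]≡m⊖n ∣ B ∪ ⁅ c ⁆ ∣ (lineExcess (B ∪ ⁅ c ⁆)) ⟩
  ∣ B ∪ ⁅ c ⁆ ∣ ⊖ lineExcess (B ∪ ⁅ c ⁆)
    ≡⟨ cong (_⊖ lineExcess (B ∪ ⁅ c ⁆)) (∣∪⁅new⁆∣ B c c∉B) ⟩
  suc ∣ B ∣ ⊖ lineExcess (B ∪ ⁅ c ⁆)
    ≤⟨ ℤP.⊖-monoʳ-≥-≤ (suc ∣ B ∣) (lineExcess-mono {B ∪ ⁅ c ⁆} {B} (p⊆p∪q ⁅ c ⁆)) ⟩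
  suc ∣ B ∣ ⊖ lineExcess B
    ≡⟨ ℤP.distribʳ-⊖-+-pos 1 ∣ B ∣ (lineExcess B) ⟨
  + 1 ℤ.+ (∣ B ∣ ⊖ lineExcess B)
    ≡⟨ cong (ℤ._+_ (+ 1)) (ℤP.[+m]-[+n]≡m⊖n ∣ B ∣ (lineExcess B)) ⟨
  + 1 ℤ.+ δ P B ∎
  where
    open ℤP.≤-Reasoning
    open Lines P

≡⊤-or-missing : ∀ {n} (X : Subset n) → X ≡ ⊤ ⊎ ∃ λ x → x ∉ X
≡⊤-or-missing {n} X with all? (_∈? X)
... | yes all∈ = inj₁ (⊆-antisym ⊆⊤ (λ {x} _ → all∈ x))
... | no ¬all∈ = inj₂ (¬∀⟶∃¬ n (Subset._∈ X) (_∈? X) ¬all∈)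

¬⊂⊤⇒≡⊤ : ∀ {n} {X : Subset n} → ¬ (X ⊂ ⊤) → X ≡ ⊤
¬⊂⊤⇒≡⊤ {X = X} ¬X⊂⊤ with ≡⊤-or-missing X
... | inj₁ X≡⊤ = X≡⊤
... | inj₂ (x , x∉X) = contradiction ((λ {_} _ → ∈⊤) , x , ∈⊤ , x∉X) ¬X⊂⊤

≤ₛ-restrict : ∀ {n} (P : Plane n) {A D Y : Subset n} → _≤ₛ_ P A D → A ⊆ Y → Y ⊆ D → _≤ₛ_ P A Y
≤ₛ-restrict P (_ , A-min) A⊆Y Y⊆D = A⊆Y , λ X A⊆X X⊆Y → A-min X A⊆X (Y⊆D ∘ X⊆Y)

between-0-1 : ∀ {g : ℤ} → + 0 ℤ.≤ g → g ℤ.≤ + 1 → g ≡ + 0 ⊎ g ≡ + 1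
between-0-1 {+ zero} _ _ = inj₁ refl
between-0-1 {+ suc zero} _ _ = inj₂ refl
between-0-1 {+ suc (suc _)} _ (+≤+ (ℕ.s≤s ()))
between-0-1 { -[1+ _ ]} () _

StrongIntermediate : ∀ {n} → Plane n → Subset n → Subset n → Set
StrongIntermediate C B C₀ = B ⊂ C₀ × C₀ ⊂ ⊤ × _≤ₛ_ C B C₀ × _≤ₛ_ C C₀ ⊤

module PrimitiveExtension {n : ℕ} (C : Plane n) (B : Subset n)
  (B≤C : _≤ₛ_ C B ⊤) (noIntermediate : ¬ Σ (Subset n) (StrongIntermediate C B)) where

  δ-above-B : ∀ X → B ⊆ X → δ C B ℤ.≤ δ C X
  δ-above-B X B⊆X = proj₂ B≤C X B⊆X ⊆⊤

  strong⇒≡⊤ : ∀ {Y} → B ⊂ Y → _≤ₛ_ C Y ⊤ → Y ≡ ⊤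
  strong⇒≡⊤ {Y} B⊂Y Y≤C =
    ¬⊂⊤⇒≡⊤ λ Y⊂⊤ → noIntermediate (Y , B⊂Y , Y⊂⊤ , ≤ₛ-restrict C B≤C (proj₁ B⊂Y) ⊆⊤ , Y≤C)

  -- How far δ Y lies above δ B; it decreases strictly along the descent.
  height : Subset n → ℕ
  height Y = ℤ.∣ δ C Y - δ C B ∣

  height-< : ∀ X Y → B ⊆ X → δ C X ℤ.< δ C Y → height X ℕ.< height Y
  height-< X Y B⊆X δX<δY = nonneg-abs-< (ℤP.i≤j⇒0≤j-i (δ-above-B X B⊆X)) (ℤP.+-monoˡ-< (- δ C B) δX<δY)
    where
      nonneg-abs-< : ∀ {i j} → + 0 ℤ.≤ i → i ℤ.< j → ℤ.∣ i ∣ ℕ.< ℤ.∣ j ∣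
      nonneg-abs-< {+ _} {+ _} _ (+<+ i<j) = i<j

  δ⊤-least-bounded : ∀ k Y → B ⊂ Y → height Y ℕ.< k → δ C ⊤ ℤ.≤ δ C Y
  δ⊤-least-bounded zero Y _ ()
  δ⊤-least-bounded (suc k) Y B⊂Y height<1+k with δ C ⊤ ℤ.≤? δ C Y
  ... | yes δ⊤≤δY = δ⊤≤δY
  ... | no δ⊤≰δY = contradiction (subst (λ Z → δ C ⊤ ℤ.≤ δ C Z) (sym (strong⇒≡⊤ B⊂Y Y≤C)) ℤP.≤-refl) δ⊤≰δY
    where
      -- every superset X of Y has δ X ≥ δ Y, else the descent from X contradicts δ⊤ > δ Y
      Y-minimal : ∀ X → Y ⊆ X → δ C Y ℤ.≤ δ C X
      Y-minimal X Y⊆X with δ C Y ℤ.≤? δ C X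
      ... | yes δY≤δX = δY≤δX
      ... | no δY≰δX =
        let δX<δY = ℤP.≰⇒> δY≰δX
            B⊂X = ⊂-⊆-trans B⊂Y Y⊆X
            height<k = ℕP.<-≤-trans (height-< X Y (proj₁ B⊂X) δX<δY) (ℕP.≤-pred height<1+k)
        in contradiction (ℤP.≤-trans (δ⊤-least-bounded k X B⊂X height<k) (ℤP.<⇒≤ δX<δY)) δ⊤≰δY
      Y≤C : _≤ₛ_ C Y ⊤
      Y≤C = ⊆⊤ , λ X Y⊆X _ → Y-minimal X Y⊆X

  δ⊤-least : ∀ {Y} → B ⊂ Y → δ C ⊤ ℤ.≤ δ C Y
  δ⊤-least {Y} B⊂Y = δ⊤-least-bounded (suc (height Y)) Y B⊂Y ℕP.≤-refl

  gap : ℤ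
  gap = δ C ⊤ - δ C B

  module _ {c : Fin n} (c∉B : c ∉ B) where

    private
      B⊂B∪c : B ⊂ B ∪ ⁅ c ⁆
      B⊂B∪c = p⊆p∪q ⁅ c ⁆ , c , q⊆p∪q B ⁅ c ⁆ (x∈⁅x⁆ c) , c∉B

    -- δ B ≤ δ C ≤ δ (B ∪ {c}) ≤ 1 + δ B.
    gap-0-or-1 : gap ≡ + 0 ⊎ gap ≡ + 1
    gap-0-or-1 = between-0-1 (ℤP.i≤j⇒0≤j-i (δ-above-B ⊤ ⊆⊤)) gap≤1
      where
        gap≤1 : gap ℤ.≤ + 1
        gap≤1 = subst (gap ℤ.≤_) (//-rightDividesʳ (δ C B) (+ 1))
                  (ℤP.+-monoˡ-≤ (- δ C B) (ℤP.≤-trans (δ⊤-least B⊂B∪c) (δ-adjoin C c∉B)))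

    -- With gap 1, B ∪ {c} is strong in C, hence is all of C.
    gap-1⇒adjoin-is-everything : gap ≡ + 1 → B ∪ ⁅ c ⁆ ≡ ⊤
    gap-1⇒adjoin-is-everything gap≡1 = strong⇒≡⊤ B⊂B∪c (⊆⊤ , λ Y B∪c⊆Y _ → begin
        δ C (B ∪ ⁅ c ⁆) ≤⟨ δ-adjoin C c∉B ⟩
        + 1 ℤ.+ δ C B   ≡⟨ cong (ℤ._+ δ C B) gap≡1 ⟨
        gap ℤ.+ δ C B   ≡⟨ //-rightDividesˡ (δ C B) (δ C ⊤) ⟩
        δ C ⊤           ≤⟨ δ⊤-least (⊂-⊆-trans B⊂B∪c B∪c⊆Y) ⟩
        δ C Y           ∎)
      where open ℤP.≤-Reasoning

    classification : (gap ≡ + 1 × ∃ λ c′ → ⊤ ≡ B ∪ ⁅ c′ ⁆) ⊎ gap ≡ + 0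
    classification with gap-0-or-1
    ... | inj₁ gap≡0 = inj₂ gap≡0
    ... | inj₂ gap≡1 = inj₁ (gap≡1 , c , sym (gap-1⇒adjoin-is-everything gap≡1))

lemma3p34 : (n : ℕ) (C : Plane n) (B : Subset n) →
    InK₀ C B → InK₀ C ⊤ →
    _≤ₛ_ C B ⊤ →
    ¬ (Σ (Subset n) λ C₀ → B ⊂ C₀ × C₀ ⊂ ⊤ × _≤ₛ_ C B C₀ × _≤ₛ_ C C₀ ⊤) →
    ((δ C ⊤ - δ C B ≡ + 1) × (∃ λ (c : Fin n) → ⊤ ≡ B ∪ ⁅ c ⁆))
    ⊎ (δ C ⊤ - δ C B ≡ + 0)
lemma3p34 n C B _ _ B≤C noIntermediate with ≡⊤-or-missing B
... | inj₁ refl = inj₂ (ℤP.+-inverseʳ (δ C ⊤))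
... | inj₂ (_ , c∉B) = PrimitiveExtension.classification C B B≤C noIntermediate c∉B
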